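{- Let $v,w\in\mathcal{S}_d$. If $v$ and $w$ are c-Wilf-equivalent in words, then they are c-Wilf-equivalent in permutations. If $v$ and $w$ are strongly c-Wilf-equivalent in words, then they are strongly c-Wilf-equivalent in permutations.
   Context: For a word $u=u_1\cdots u_n$, a consecutive occurrence of $v\in\mathcal{S}_d$ is an index $j$, $1\le j\le n-d+1$, with $u_j\cdots u_{j+d-1}$ order-isomorphic to $v$ (for all $p,q$: $u_{j+p-1}<u_{j+q-1}\iff v_p<v_q$ and $u_{j+p-1}=u_{j+q-1}\iff v_p=v_q$); $\mathrm{con}_v(u)$ counts them. For a set of words $\mathcal{A}$, $g_r^v(\mathcal{A})=\#\{u\in\mathcal{A}:\mathrm{con}_v(u)=r\}$. $[k]^n$ is the set of words of length $n$ over $[k]=\{1,\dots,k\}$, $\mathcal{S}_n$ the set of permutations of $[n]$ as words. $v,w$ are c-Wilf-equivalent in words if $g_0^v([k]^n)=g_0^w([k]^n)$ for all $k,n\in\mathbb{N}$; strongly c-Wilf-equivalent in words if $g_r^v([k]^n)=g_r^w([k]^n)$ for all $k,n\in\mathbb{N}$, $r\in\mathbb{N}_0$; c-Wilf-equivalent in permutations if $g_0^v(\mathcal{S}_n)=g_0^w(\mathcal{S}_n)$ for all $n\in\mathbb{N}$; strongly c-Wilf-equivalent in permutations if $g_r^v(\mathcal{S}_n)=g_r^w(\mathcal{S}_n)$ for all $n\in\mathbb{N}$, $r\in\mathbb{N}_0$. -}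

module Defs where

open import Data.Nat using (ℕ; zero; suc; _≤ᵇ_; _<ᵇ_; _≡ᵇ_)
open import Data.Bool using (Bool; true; false; _∧_; if_then_else_; not; T)
open import Data.Bool.Properties using () renaming (_≟_ to _≟B_)
open import Data.Fin using (Fin; toℕ)
open import Data.Fin.Base using () 
open import Data.List using (List; []; _∷_; _++_; length; take; map; filter; concatMap; zip)
open import Data.Bool.ListAction using (all; any)
import Data.Vec as V
open V using (Vec; toList)
open import Data.Product using (_×_; _,_; proj₁; proj₂)
open import Data.List.Base using (allFin)
open import Relation.Binary.PropositionalEquality using (_≡_)

-- A word of length n over [k] is a vector of letters Fin k
-- (letter i : Fin k stands for i+1 ∈ [k]; only the order matters).
Word : ℕ → ℕ → Set
Word k n = Vec (Fin k) n

allWords : (k n : ℕ) → List (Word k n)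
allWords k zero    = V.[] ∷ []
allWords k (suc n) = concatMap (λ a → map (a V.∷_) (allWords k n)) (allFin k)

distinctᵇ : List ℕ → Bool
distinctᵇ []       = true
distinctᵇ (x ∷ xs) = not (any (λ y → x ≡ᵇ y) xs) ∧ distinctᵇ xs

-- a word of length n over [n] is a permutation iff its letters are distinct
IsPerm : ∀ {n} → Word n n → Set
IsPerm u = T (distinctᵇ (map toℕ (toList u)))

allPerms : (n : ℕ) → List (Word n n)
allPerms n = filter (λ u → T? (distinctᵇ (map toℕ (toList u)))) (allWords n n)
  where
  open import Relation.Nullary using (Dec; yes; no)
  open import Data.Bool.Properties using (T?)

windows : ℕ → List ℕ → List (List ℕ)
windows zero    []       = [] ∷ []
windows (suc d) []       = []
windows d       (x ∷ xs) =
  (if d ≤ᵇ length (x ∷ xs) then take d (x ∷ xs) ∷ [] else []) ++ windows d xs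

orderIsoᵇ : List ℕ → List ℕ → Bool
orderIsoᵇ as bs =
  (length as ≡ᵇ length bs) ∧
  all (λ x → all (λ y →
        ((proj₁ x <ᵇ proj₁ y) ≡B (proj₂ x <ᵇ proj₂ y)) ∧
        ((proj₁ x ≡ᵇ proj₁ y) ≡B (proj₂ x ≡ᵇ proj₂ y))) ps) ps
  where
  ps = zip as bs
  _≡B_ : Bool → Bool → Bool
  true  ≡B b = b
  false ≡B b = not b

con : ∀ {d k n} → Word d d → Word k n → ℕ
con {d} v u =
  length (filter (λ s → T? (orderIsoᵇ s (map toℕ (toList v))))
                 (windows d (map toℕ (toList u))))
  where open import Data.Bool.Properties using (T?)

g : ∀ {d k n} → ℕ → Word d d → List (Word k n) → ℕ
g r v A = length (filter (λ u → T? (con v u ≡ᵇ r)) A)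
  where open import Data.Bool.Properties using (T?)

-- ℕ = {1,2,...} in the paper
cWilfWords : ∀ {d} → Word d d → Word d d → Set
cWilfWords v w = ∀ k n → 1 Data.Nat.≤ k → 1 Data.Nat.≤ n →
  g 0 v (allWords k n) ≡ g 0 w (allWords k n)
  where import Data.Nat

strongCWilfWords : ∀ {d} → Word d d → Word d d → Set
strongCWilfWords v w = ∀ k n r → 1 Data.Nat.≤ k → 1 Data.Nat.≤ n →
  g r v (allWords k n) ≡ g r w (allWords k n)
  where import Data.Nat

cWilfPerms : ∀ {d} → Word d d → Word d d → Set
cWilfPerms v w = ∀ n → 1 Data.Nat.≤ n →
  g 0 v (allPerms n) ≡ g 0 w (allPerms n)
  where import Data.Nat

strongCWilfPerms : ∀ {d} → Word d d → Word d d → Set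
strongCWilfPerms v w = ∀ n r → 1 Data.Nat.≤ n →
  g r v (allPerms n) ≡ g r w (allPerms n)
  where import Data.Nat

-- A property P of words that only sees the relative order of letters (such as
-- "exactly r occurrences of v") is determined, for a fixed length, by how many
-- words over [k] satisfy it for every k. Let C(k, m) count the words over [k]
-- satisfying P in which every letter below m occurs. Among the words over [k+1]
-- containing the letters below m, those missing the letter m are, after closing
-- the gap at m, exactly such words over [k]; hence C(k+1, m) = C(k+1, m+1) + C(k, m),
-- and starting from C(k, 0) every C(k, m) with m ≤ k is determined by the word
-- counts. Finally, by pigeonhole the permutations of [n] are the words of length n
-- over [n] containing every letter, counted by C(n, n).
module Submission where

open import Defs
open import Data.Nat using (ℕ; zero; suc; _+_; _≤_; _<_; z≤n; s≤s; s<s; _<ᵇ_; _≡ᵇ_; _≤ᵇ_)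
open import Data.Nat.Properties

open import Algebra.Properties.CommutativeMonoid.Sum +-0-commutativeMonoid
  using (sum-syntax; sum-remove; sum-cong-≗; sum-replicate-zero; ∑-distrib-+)
open import Algebra.Properties.CommutativeSemigroup +-commutativeSemigroup using (x∙yz≈y∙xz)
open import Data.Bool using (Bool; true; false; T; _∧_; _∨_; not; if_then_else_)
open import Data.Bool.ListAction using (all; and; any)
open import Data.Bool.Properties using (T?; T-≡; if-float; ∧-assoc)
open import Data.Empty using (⊥-elim)
open import Data.Fin using (Fin; toℕ; punchIn; fromℕ<) renaming (zero to fzero; suc to fsuc)
open import Data.Fin.Properties using (toℕ<n; toℕ-fromℕ<; toℕ-injective; punchInᵢ≢i)
open import Data.List using (List; []; _∷_; _++_; map; zip; length; filter; take; concatMap; tabulate)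
open import Data.List.Properties using (map-∘; map-cong; map-id; map-++; length-map; take-map; zip-map)
open import Data.List.Relation.Unary.All using (All; []; _∷_)
import Data.Product as Product
open import Data.Product using (_×_; _,_)
open import Data.Sum using (inj₁; inj₂)
open import Data.Vec using (toList) renaming (_∷_ to _∷ᵛ_)
open import Function using (_∘_; id)
open import Function.Bundles using (Equivalence)
open import Relation.Binary using (_Preserves_⟶_; tri<; tri≈; tri>)
open import Relation.Binary.PropositionalEquality
open import Relation.Nullary.Reflects using (ofʸ; ofⁿ)
open ≡-Reasoning

𝟙 : Bool → ℕ
𝟙 true  = 1
𝟙 false = 0

T-ext : ∀ {x y} → (T x → T y) → (T y → T x) → x ≡ y
T-ext {false} {false} _ _ = refl
T-ext {false} {true}  _ g = ⊥-elim (g _)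
T-ext {true}  {false} f _ = ⊥-elim (f _)
T-ext {true}  {true}  _ _ = refl

≡ᵇ-refl : ∀ n → (n ≡ᵇ n) ≡ true
≡ᵇ-refl n = Equivalence.to T-≡ (≡⇒≡ᵇ n n refl)

≡ᵇ-false : ∀ {m n} → m ≢ n → (m ≡ᵇ n) ≡ false
≡ᵇ-false m≢n = T-ext (m≢n ∘ ≡ᵇ⇒≡ _ _) ⊥-elim

memᵇ : ℕ → List ℕ → Bool
memᵇ j = any (j ≡ᵇ_)

count : {A : Set} → (A → Bool) → List A → ℕ
count p []       = 0
count p (x ∷ xs) = 𝟙 (p x) + count p xs

length-filter-T? : {A : Set} (p : A → Bool) (xs : List A) →
  length (filter (λ x → T? (p x)) xs) ≡ count p xs
length-filter-T? p []       = refl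
length-filter-T? p (x ∷ xs) with p x
... | true  = cong suc (length-filter-T? p xs)
... | false = length-filter-T? p xs

count-filter : {A : Set} (c p : A → Bool) (xs : List A) →
  count p (filter (λ x → T? (c x)) xs) ≡ count (λ x → c x ∧ p x) xs
count-filter c p []       = refl
count-filter c p (x ∷ xs) with c x
... | true  = cong (𝟙 (p x) +_) (count-filter c p xs)
... | false = count-filter c p xs

count-cong : {A : Set} {p q : A → Bool} → (∀ x → p x ≡ q x) → ∀ xs → count p xs ≡ count q xs
count-cong p≡q []       = refl
count-cong p≡q (x ∷ xs) = cong₂ _+_ (cong 𝟙 (p≡q x)) (count-cong p≡q xs)

count-map : {A B : Set} (p : B → Bool) (f : A → B) (xs : List A) → count p (map f xs) ≡ count (p ∘ f) xs
count-map p f []       = refl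
count-map p f (x ∷ xs) = cong (𝟙 (p (f x)) +_) (count-map p f xs)

count-++ : {A : Set} (p : A → Bool) (xs ys : List A) → count p (xs ++ ys) ≡ count p xs + count p ys
count-++ p []       ys = refl
count-++ p (x ∷ xs) ys = trans (cong (𝟙 (p x) +_) (count-++ p xs ys)) (sym (+-assoc (𝟙 (p x)) _ _))

count-concatMap-tabulate : {A B : Set} (p : B → Bool) (h : A → List B) (k : ℕ) (F : Fin k → A) →
  count p (concatMap h (tabulate F)) ≡ ∑[ i < k ] count p (h (F i))
count-concatMap-tabulate p h zero    F = refl
count-concatMap-tabulate p h (suc k) F =
  trans (count-++ p (h (F fzero)) _) (cong (_ +_) (count-concatMap-tabulate p h k (F ∘ fsuc)))

allPairs : {A : Set} → (A → A → Bool) → List A → Bool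
allPairs R xs = all (λ x → all (R x) xs) xs

allPairs-cong : {A : Set} {R S : A → A → Bool} → (∀ x y → R x y ≡ S x y) →
  ∀ xs → allPairs R xs ≡ allPairs S xs
allPairs-cong R≡S xs = cong and (map-cong (λ x → cong and (map-cong (R≡S x) xs)) xs)

allPairs-map : {A B : Set} (R : B → B → Bool) (h : A → B) (xs : List A) →
  allPairs R (map h xs) ≡ allPairs (λ x y → R (h x) (h y)) xs
allPairs-map R h xs = cong and (trans (sym (map-∘ xs)) (map-cong (λ x → cong and (sym (map-∘ xs))) xs))

_⇔ᵇ_ : Bool → Bool → Bool
true  ⇔ᵇ y = y
false ⇔ᵇ y = not y

sameOrderᵇ : ℕ × ℕ → ℕ × ℕ → Bool
sameOrderᵇ (a , b) (c , e) = ((a <ᵇ c) ⇔ᵇ (b <ᵇ e)) ∧ ((a ≡ᵇ c) ⇔ᵇ (b ≡ᵇ e))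

-- orderIsoᵇ compares booleans with a where-bound function that cannot be named
-- from outside; its pairwise test is instead identified through its values on
-- zero and suc, which hold by computation.
sameOrderᵇ-unique : (P : ℕ × ℕ → ℕ × ℕ → Bool) →
  (∀ b e → P (0 , b) (0 , e) ≡ not (b <ᵇ e) ∧ (b ≡ᵇ e)) →
  (∀ c b e → P (0 , b) (suc c , e) ≡ (b <ᵇ e) ∧ not (b ≡ᵇ e)) →
  (∀ a b e → P (suc a , b) (0 , e) ≡ not (b <ᵇ e) ∧ not (b ≡ᵇ e)) →
  (∀ a c b e → P (suc a , b) (suc c , e) ≡ P (a , b) (c , e)) →
  ∀ x y → P x y ≡ sameOrderᵇ x y
sameOrderᵇ-unique P p00 p0s ps0 pss (zero  , b) (zero  , e) = p00 b e
sameOrderᵇ-unique P p00 p0s ps0 pss (zero  , b) (suc c , e) = p0s c b e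
sameOrderᵇ-unique P p00 p0s ps0 pss (suc a , b) (zero  , e) = ps0 a b e
sameOrderᵇ-unique P p00 p0s ps0 pss (suc a , b) (suc c , e) =
  trans (pss a c b e) (sameOrderᵇ-unique P p00 p0s ps0 pss (a , b) (c , e))

orderIsoᵇ-unfold : ∀ s V → orderIsoᵇ s V ≡ (length s ≡ᵇ length V) ∧ allPairs sameOrderᵇ (zip s V)
orderIsoᵇ-unfold s V = cong ((length s ≡ᵇ length V) ∧_) (allPairs-cong
  (sameOrderᵇ-unique _ (λ _ _ → refl) (λ _ _ _ → refl) (λ _ _ _ → refl) (λ _ _ _ _ → refl)) (zip s V))

zip-mapˡ : {A B C : Set} (f : A → B) (xs : List A) (ys : List C) →
  zip (map f xs) ys ≡ map (Product.map₁ f) (zip xs ys)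
zip-mapˡ f xs ys = trans (cong (zip (map f xs)) (sym (map-id ys))) (zip-map f id xs ys)

module _ {f : ℕ → ℕ} (f-mono : f Preserves _<_ ⟶ _<_) where

  mono-cancel-< : ∀ {a c} → f a < f c → a < c
  mono-cancel-< {a} {c} fa<fc with <-cmp a c
  ... | tri< a<c _ _  = a<c
  ... | tri≈ _ refl _ = ⊥-elim (<-irrefl refl fa<fc)
  ... | tri> _ _ c<a  = ⊥-elim (<-asym fa<fc (f-mono c<a))

  mono-injective : ∀ {a c} → f a ≡ f c → a ≡ c
  mono-injective {a} {c} fa≡fc with <-cmp a c
  ... | tri< a<c _ _ = ⊥-elim (<-irrefl fa≡fc (f-mono a<c))
  ... | tri≈ _ a≡c _ = a≡c
  ... | tri> _ _ c<a = ⊥-elim (<-irrefl (sym fa≡fc) (f-mono c<a))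

  mono-<ᵇ : ∀ a c → (f a <ᵇ f c) ≡ (a <ᵇ c)
  mono-<ᵇ a c = T-ext (<⇒<ᵇ ∘ mono-cancel-< ∘ <ᵇ⇒< _ _) (<⇒<ᵇ ∘ f-mono ∘ <ᵇ⇒< _ _)

  mono-≡ᵇ : ∀ a c → (f a ≡ᵇ f c) ≡ (a ≡ᵇ c)
  mono-≡ᵇ a c = T-ext (≡⇒≡ᵇ _ _ ∘ mono-injective ∘ ≡ᵇ⇒≡ _ _) (≡⇒≡ᵇ _ _ ∘ cong f ∘ ≡ᵇ⇒≡ _ _)

  memᵇ-map : ∀ j L → memᵇ (f j) (map f L) ≡ memᵇ j L
  memᵇ-map j []      = refl
  memᵇ-map j (x ∷ L) = cong₂ _∨_ (mono-≡ᵇ j x) (memᵇ-map j L)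

  sameOrderᵇ-map : ∀ x y → sameOrderᵇ (Product.map₁ f x) (Product.map₁ f y) ≡ sameOrderᵇ x y
  sameOrderᵇ-map (a , _) (c , _) rewrite mono-<ᵇ a c | mono-≡ᵇ a c = refl

  orderIsoᵇ-map : ∀ s V → orderIsoᵇ (map f s) V ≡ orderIsoᵇ s V
  orderIsoᵇ-map s V = begin
    orderIsoᵇ (map f s) V
      ≡⟨ orderIsoᵇ-unfold (map f s) V ⟩
    (length (map f s) ≡ᵇ length V) ∧ allPairs sameOrderᵇ (zip (map f s) V)
      ≡⟨ cong₂ _∧_ (cong (_≡ᵇ length V) (length-map f s)) (cong (allPairs sameOrderᵇ) (zip-mapˡ f s V)) ⟩
    (length s ≡ᵇ length V) ∧ allPairs sameOrderᵇ (map (Product.map₁ f) (zip s V))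
      ≡⟨ cong (_ ∧_) (trans (allPairs-map sameOrderᵇ _ (zip s V)) (allPairs-cong sameOrderᵇ-map (zip s V))) ⟩
    (length s ≡ᵇ length V) ∧ allPairs sameOrderᵇ (zip s V)
      ≡⟨ orderIsoᵇ-unfold s V ⟨
    orderIsoᵇ s V ∎

firstWindow : ℕ → List ℕ → List (List ℕ)
firstWindow d xs = if d ≤ᵇ length xs then take d xs ∷ [] else []

windows-∷ : ∀ d x L → windows d (x ∷ L) ≡ firstWindow d (x ∷ L) ++ windows d L
windows-∷ zero    x L = refl
windows-∷ (suc d) x L = refl

firstWindow-map : ∀ d (f : ℕ → ℕ) L → firstWindow d (map f L) ≡ map (map f) (firstWindow d L)
firstWindow-map d f L rewrite length-map f L | take-map {f = f} d L =
  sym (if-float (map (map f)) (d ≤ᵇ length L))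

windows-map : ∀ d (f : ℕ → ℕ) L → windows d (map f L) ≡ map (map f) (windows d L)
windows-map zero    f []      = refl
windows-map (suc d) f []      = refl
windows-map d       f (x ∷ L) = begin
  windows d (map f (x ∷ L))
    ≡⟨ windows-∷ d (f x) (map f L) ⟩
  firstWindow d (map f (x ∷ L)) ++ windows d (map f L)
    ≡⟨ cong₂ _++_ (firstWindow-map d f (x ∷ L)) (windows-map d f L) ⟩
  map (map f) (firstWindow d (x ∷ L)) ++ map (map f) (windows d L)
    ≡⟨ map-++ (map f) (firstWindow d (x ∷ L)) (windows d L) ⟨
  map (map f) (firstWindow d (x ∷ L) ++ windows d L)
    ≡⟨ cong (map (map f)) (windows-∷ d x L) ⟨
  map (map f) (windows d (x ∷ L)) ∎

occurrences : ℕ → List ℕ → List ℕ → ℕ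
occurrences d V L = count (λ s → orderIsoᵇ s V) (windows d L)

OrderInvariant : (List ℕ → Bool) → Set
OrderInvariant P = ∀ {f} → f Preserves _<_ ⟶ _<_ → ∀ L → P (map f L) ≡ P L

occurrences-map : ∀ {f} → f Preserves _<_ ⟶ _<_ →
  ∀ d V L → occurrences d V (map f L) ≡ occurrences d V L
occurrences-map {f} f-mono d V L = begin
  count (λ s → orderIsoᵇ s V) (windows d (map f L))
    ≡⟨ cong (count _) (windows-map d f L) ⟩
  count (λ s → orderIsoᵇ s V) (map (map f) (windows d L))
    ≡⟨ count-map _ (map f) (windows d L) ⟩
  count (λ s → orderIsoᵇ (map f s) V) (windows d L)
    ≡⟨ count-cong (λ s → orderIsoᵇ-map f-mono s V) (windows d L) ⟩
  count (λ s → orderIsoᵇ s V) (windows d L) ∎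

occursExactly : ℕ → List ℕ → ℕ → List ℕ → Bool
occursExactly d V r L = occurrences d V L ≡ᵇ r

occursExactly-invariant : ∀ d V r → OrderInvariant (occursExactly d V r)
occursExactly-invariant d V r f-mono L = cong (_≡ᵇ r) (occurrences-map f-mono d V L)

punchInℕ : ℕ → ℕ → ℕ
punchInℕ t x = if x <ᵇ t then x else suc x

toℕ-punchIn : ∀ {k} (i : Fin (suc k)) (j : Fin k) → toℕ (punchIn i j) ≡ punchInℕ (toℕ i) (toℕ j)
toℕ-punchIn         fzero    j        = refl
toℕ-punchIn {suc k} (fsuc i) fzero    = refl
toℕ-punchIn {suc k} (fsuc i) (fsuc j) =
  trans (cong suc (toℕ-punchIn i j)) (if-float suc (toℕ j <ᵇ toℕ i))

punchInℕ-mono : ∀ t → punchInℕ t Preserves _<_ ⟶ _<_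
punchInℕ-mono t {a} {c} a<c with a <ᵇ t | <ᵇ-reflects-< a t | c <ᵇ t | <ᵇ-reflects-< c t
... | true  | _        | true  | _       = a<c
... | true  | _        | false | _       = m<n⇒m<1+n a<c
... | false | ofⁿ a≮t | true  | ofʸ c<t = ⊥-elim (a≮t (<-trans a<c c<t))
... | false | _        | false | _       = s<s a<c

punchInℕ-below : ∀ {t x} → x < t → punchInℕ t x ≡ x
punchInℕ-below x<t rewrite Equivalence.to T-≡ (<⇒<ᵇ x<t) = refl

#words : ℕ → ℕ → (List ℕ → Bool) → ℕ
#words k zero    Q = 𝟙 (Q [])
#words k (suc n) Q = ∑[ a < k ] #words k n (λ L → Q (toℕ a ∷ L))

letters : ∀ {k n} → Word k n → List ℕ
letters u = map toℕ (toList u)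

count-allWords : ∀ k n (Q : List ℕ → Bool) → count (Q ∘ letters) (allWords k n) ≡ #words k n Q
count-allWords k zero    Q = +-identityʳ (𝟙 (Q []))
count-allWords k (suc n) Q = begin
  count (Q ∘ letters) (allWords k (suc n))
    ≡⟨ count-concatMap-tabulate (Q ∘ letters) _ k id ⟩
  ∑[ a < k ] count (Q ∘ letters) (map (a ∷ᵛ_) (allWords k n))
    ≡⟨ sum-cong-≗ {k} (λ a → count-map (Q ∘ letters) (a ∷ᵛ_) (allWords k n)) ⟩
  ∑[ a < k ] count (λ u → Q (toℕ a ∷ letters u)) (allWords k n)
    ≡⟨ sum-cong-≗ {k} (λ a → count-allWords k n (λ L → Q (toℕ a ∷ L))) ⟩
  #words k (suc n) Q ∎

#words-cong : ∀ {k} n {Q Q′ : List ℕ → Bool} →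
  (∀ L → length L ≡ n → All (_< k) L → Q L ≡ Q′ L) → #words k n Q ≡ #words k n Q′
#words-cong zero    Q≡Q′ = cong 𝟙 (Q≡Q′ [] refl [])
#words-cong {k} (suc n) Q≡Q′ =
  sum-cong-≗ {k} (λ a → #words-cong n (λ L |L|≡n L<k → Q≡Q′ (toℕ a ∷ L) (cong suc |L|≡n) (toℕ<n a ∷ L<k)))

#words-split : ∀ k n (b Q : List ℕ → Bool) →
  #words k n Q ≡ #words k n (λ L → b L ∧ Q L) + #words k n (λ L → not (b L) ∧ Q L)
#words-split k zero    b Q with b []
... | true  = sym (+-identityʳ _)
... | false = refl
#words-split k (suc n) b Q =
  trans (sum-cong-≗ {k} (λ a → #words-split k n (b ∘ (toℕ a ∷_)) (Q ∘ (toℕ a ∷_)))) (∑-distrib-+ {k} _ _)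

#words-false : ∀ k n → #words k n (λ _ → false) ≡ 0
#words-false k zero    = refl
#words-false k (suc n) = trans (sum-cong-≗ {k} (λ _ → #words-false k n)) (sum-replicate-zero k)

#words-avoiding : ∀ {k t} n → t ≤ k → (Q : List ℕ → Bool) →
  #words (suc k) n (λ L → not (memᵇ t L) ∧ Q L) ≡ #words k n (Q ∘ map (punchInℕ t))
#words-avoiding         zero    t≤k Q = refl
#words-avoiding {k} {t} (suc n) t≤k Q = begin
  ∑[ a < suc k ] avoiding (toℕ a)
    ≡⟨ sum-remove {i = i} (avoiding ∘ toℕ) ⟩
  avoiding (toℕ i) + ∑[ b < k ] avoiding (toℕ (punchIn i b))
    ≡⟨ cong₂ _+_ t-present (sum-cong-≗ {k} other-letter) ⟩
  ∑[ b < k ] #words k n (λ L → Q (punchInℕ t (toℕ b) ∷ map (punchInℕ t) L)) ∎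
  where
  i : Fin (suc k)
  i = fromℕ< (s≤s t≤k)
  toℕ-i : toℕ i ≡ t
  toℕ-i = toℕ-fromℕ< (s≤s t≤k)
  avoiding : ℕ → ℕ
  avoiding a = #words (suc k) n (λ L → not (memᵇ t (a ∷ L)) ∧ Q (a ∷ L))
  t-present : avoiding (toℕ i) ≡ 0
  t-present rewrite toℕ-i | ≡ᵇ-refl t = #words-false (suc k) n
  t≢punchIn : ∀ b → t ≢ toℕ (punchIn i b)
  t≢punchIn b t≡ = punchInᵢ≢i i b (toℕ-injective (trans (sym t≡) (sym toℕ-i)))
  other-letter : ∀ b →
    avoiding (toℕ (punchIn i b)) ≡ #words k n (λ L → Q (punchInℕ t (toℕ b) ∷ map (punchInℕ t) L))
  other-letter b rewrite ≡ᵇ-false (t≢punchIn b) | toℕ-punchIn i b | toℕ-i =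
    #words-avoiding n t≤k (λ L → Q (punchInℕ t (toℕ b) ∷ L))

covers : ℕ → List ℕ → Bool
covers zero    L = true
covers (suc m) L = memᵇ m L ∧ covers m L

covers-map : ∀ {f} → f Preserves _<_ ⟶ _<_ → ∀ m → (∀ {j} → j < m → f j ≡ j) →
  ∀ L → covers m (map f L) ≡ covers m L
covers-map f-mono zero    fixed L = refl
covers-map {f} f-mono (suc m) fixed L = cong₂ _∧_
  (trans (cong (λ j → memᵇ j (map f L)) (sym (fixed (n<1+n m)))) (memᵇ-map f-mono m L))
  (covers-map f-mono m (fixed ∘ m<n⇒m<1+n) L)

#covering : ℕ → ℕ → ℕ → (List ℕ → Bool) → ℕ
#covering k n m P = #words k n (λ L → covers m L ∧ P L)

#covering-step : ∀ {k m} n {P} → OrderInvariant P → m ≤ k →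
  #covering (suc k) n m P ≡ #covering (suc k) n (suc m) P + #covering k n m P
#covering-step {k} {m} n {P} P-inv m≤k = begin
  #covering (suc k) n m P
    ≡⟨ #words-split (suc k) n (memᵇ m) _ ⟩
  #words (suc k) n (λ L → memᵇ m L ∧ (covers m L ∧ P L))
    + #words (suc k) n (λ L → not (memᵇ m L) ∧ (covers m L ∧ P L))
    ≡⟨ cong₂ _+_ (#words-cong n (λ L _ _ → sym (∧-assoc (memᵇ m L) _ _))) (#words-avoiding n m≤k _) ⟩
  #covering (suc k) n (suc m) P + #words k n (λ L → covers m (map (punchInℕ m) L) ∧ P (map (punchInℕ m) L))
    ≡⟨ cong (#covering (suc k) n (suc m) P +_) (#words-cong n (λ L _ _ → gap-invariant L)) ⟩
  #covering (suc k) n (suc m) P + #covering k n m P ∎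
  where
  gap-invariant : ∀ L → covers m (map (punchInℕ m) L) ∧ P (map (punchInℕ m) L) ≡ covers m L ∧ P L
  gap-invariant L =
    cong₂ _∧_ (covers-map (punchInℕ-mono m) m punchInℕ-below L) (P-inv (punchInℕ-mono m) L)

#covering-equal : ∀ n {P P′} → OrderInvariant P → OrderInvariant P′ →
  (∀ k → #words k n P ≡ #words k n P′) → ∀ m k → m ≤ k → #covering k n m P ≡ #covering k n m P′
#covering-equal n P-inv P′-inv same-words zero    k       _         = same-words k
#covering-equal n {P} {P′} P-inv P′-inv same-words (suc m) (suc k) (s≤s m≤k) = +-cancelʳ-≡ _ _ _ (begin
  #covering (suc k) n (suc m) P + #covering k n m P
    ≡⟨ #covering-step n P-inv m≤k ⟨
  #covering (suc k) n m P
    ≡⟨ IH (suc k) (m≤n⇒m≤1+n m≤k) ⟩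
  #covering (suc k) n m P′
    ≡⟨ #covering-step n P′-inv m≤k ⟩
  #covering (suc k) n (suc m) P′ + #covering k n m P′
    ≡⟨ cong (_ +_) (IH k m≤k) ⟨
  #covering (suc k) n (suc m) P′ + #covering k n m P ∎)
  where IH = #covering-equal n P-inv P′-inv same-words m

#occurring : ℕ → List ℕ → ℕ
#occurring zero    L = 0
#occurring (suc m) L = 𝟙 (memᵇ m L) + #occurring m L

#occurring≤ : ∀ m L → #occurring m L ≤ m
#occurring≤ zero    L = z≤n
#occurring≤ (suc m) L with memᵇ m L
... | true  = s≤s (#occurring≤ m L)
... | false = m≤n⇒m≤1+n (#occurring≤ m L)

covers≡ : ∀ m L → covers m L ≡ (#occurring m L ≡ᵇ m)
covers≡ zero    L = refl
covers≡ (suc m) L with memᵇ m L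
... | true  = covers≡ m L
... | false = sym (≡ᵇ-false (<⇒≢ (s≤s (#occurring≤ m L))))

#occurring-[] : ∀ m → #occurring m [] ≡ 0
#occurring-[] zero    = refl
#occurring-[] (suc m) = #occurring-[] m

#occurring-∷-≥ : ∀ {m x} L → m ≤ x → #occurring m (x ∷ L) ≡ #occurring m L
#occurring-∷-≥ {zero}      L _   = refl
#occurring-∷-≥ {suc m} {x} L m<x
  rewrite ≡ᵇ-false (<⇒≢ m<x) = cong (𝟙 (memᵇ m L) +_) (#occurring-∷-≥ L (<⇒≤ m<x))

#occurring-∷ : ∀ {m x} L → x < m → 𝟙 (memᵇ x L) + #occurring m (x ∷ L) ≡ suc (#occurring m L)
#occurring-∷ {suc m} {x} L x<1+m with m<1+n⇒m<n∨m≡n x<1+m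
... | inj₂ refl rewrite ≡ᵇ-refl x | #occurring-∷-≥ L (≤-refl {x}) = +-suc _ _
... | inj₁ x<m  rewrite ≡ᵇ-false (>⇒≢ x<m) = begin
  𝟙 (memᵇ x L) + (𝟙 (memᵇ m L) + #occurring m (x ∷ L)) ≡⟨ x∙yz≈y∙xz (𝟙 (memᵇ x L)) (𝟙 (memᵇ m L)) _ ⟩
  𝟙 (memᵇ m L) + (𝟙 (memᵇ x L) + #occurring m (x ∷ L)) ≡⟨ cong (𝟙 (memᵇ m L) +_) (#occurring-∷ L x<m) ⟩
  𝟙 (memᵇ m L) + suc (#occurring m L)                  ≡⟨ +-suc _ _ ⟩
  suc (#occurring (suc m) L)                           ∎

#occurring≤length : ∀ {m L} → All (_< m) L → #occurring m L ≤ length L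
#occurring≤length {m} []                 = ≤-reflexive (#occurring-[] m)
#occurring≤length {m} {x ∷ L} (x<m ∷ L<m) =
  ≤-trans (m≤n+m _ (𝟙 (memᵇ x L))) (≤-trans (≤-reflexive (#occurring-∷ L x<m)) (s≤s (#occurring≤length L<m)))

distinctᵇ≡ : ∀ {m L} → All (_< m) L → distinctᵇ L ≡ (#occurring m L ≡ᵇ length L)
distinctᵇ≡ {m} []                  rewrite #occurring-[] m = refl
distinctᵇ≡ {m} {x ∷ L} (x<m ∷ L<m) with memᵇ x L | #occurring-∷ L x<m
... | true  | occ≡ =
  sym (≡ᵇ-false (<⇒≢ (s≤s (subst (_≤ length L) (sym (suc-injective occ≡)) (#occurring≤length L<m)))))
... | false | occ≡ rewrite occ≡ = distinctᵇ≡ L<m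

distinctᵇ≡covers : ∀ {m L} → length L ≡ m → All (_< m) L → distinctᵇ L ≡ covers m L
distinctᵇ≡covers {m} {L} |L|≡m L<m = begin
  distinctᵇ L                     ≡⟨ distinctᵇ≡ L<m ⟩
  (#occurring m L ≡ᵇ length L)  ≡⟨ cong (#occurring m L ≡ᵇ_) |L|≡m ⟩
  (#occurring m L ≡ᵇ m)         ≡⟨ covers≡ m L ⟨
  covers m L                      ∎

occursExactlyᵛ : ∀ {d} → Word d d → ℕ → List ℕ → Bool
occursExactlyᵛ {d} v r = occursExactly d (letters v) r

con≡occurrences : ∀ {d k n} (v : Word d d) (u : Word k n) →
  con v u ≡ occurrences d (letters v) (letters u)
con≡occurrences {d} v u = length-filter-T? (λ s → orderIsoᵇ s (letters v)) (windows d (letters u))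

g-allWords : ∀ {d} (v : Word d d) r k n → g r v (allWords k n) ≡ #words k n (occursExactlyᵛ v r)
g-allWords v r k n = begin
  g r v (allWords k n)
    ≡⟨ length-filter-T? _ (allWords k n) ⟩
  count (λ u → con v u ≡ᵇ r) (allWords k n)
    ≡⟨ count-cong (λ u → cong (_≡ᵇ r) (con≡occurrences v u)) (allWords k n) ⟩
  count (occursExactlyᵛ v r ∘ letters) (allWords k n)
    ≡⟨ count-allWords k n (occursExactlyᵛ v r) ⟩
  #words k n (occursExactlyᵛ v r) ∎

g-allPerms : ∀ {d} (v : Word d d) r n → g r v (allPerms n) ≡ #covering n n n (occursExactlyᵛ v r)
g-allPerms v r n = begin
  g r v (allPerms n)
    ≡⟨ length-filter-T? _ (allPerms n) ⟩
  count (λ u → con v u ≡ᵇ r) (allPerms n)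
    ≡⟨ count-filter (distinctᵇ ∘ letters) _ (allWords n n) ⟩
  count (λ u → distinctᵇ (letters u) ∧ (con v u ≡ᵇ r)) (allWords n n)
    ≡⟨ count-cong (λ u → cong (distinctᵇ (letters u) ∧_) (cong (_≡ᵇ r) (con≡occurrences v u))) (allWords n n) ⟩
  count ((λ L → distinctᵇ L ∧ occursExactlyᵛ v r L) ∘ letters) (allWords n n)
    ≡⟨ count-allWords n n _ ⟩
  #words n n (λ L → distinctᵇ L ∧ occursExactlyᵛ v r L)
    ≡⟨ #words-cong n (λ L |L|≡n L<n → cong (_∧ occursExactlyᵛ v r L) (distinctᵇ≡covers |L|≡n L<n)) ⟩
  #covering n n n (occursExactlyᵛ v r) ∎

perms-from-words : ∀ {d} (v w : Word d d) r n → 1 ≤ n →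
  (∀ k → 1 ≤ k → g r v (allWords k n) ≡ g r w (allWords k n)) →
  g r v (allPerms n) ≡ g r w (allPerms n)
perms-from-words {d} v w r (suc n) _ same-g = begin
  g r v (allPerms (suc n))
    ≡⟨ g-allPerms v r (suc n) ⟩
  #covering (suc n) (suc n) (suc n) (occursExactlyᵛ v r)
    ≡⟨ #covering-equal (suc n) (occursExactly-invariant d (letters v) r) (occursExactly-invariant d (letters w) r)
         same-words (suc n) (suc n) ≤-refl ⟩
  #covering (suc n) (suc n) (suc n) (occursExactlyᵛ w r)
    ≡⟨ g-allPerms w r (suc n) ⟨
  g r w (allPerms (suc n)) ∎
  where
  same-words : ∀ k → #words k (suc n) (occursExactlyᵛ v r) ≡ #words k (suc n) (occursExactlyᵛ w r)
  same-words zero    = refl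
  same-words (suc k) = trans (sym (g-allWords v r (suc k) (suc n)))
    (trans (same-g (suc k) (s≤s z≤n)) (g-allWords w r (suc k) (suc n)))

corollary1 : (d : ℕ) (v w : Word d d) → IsPerm v → IsPerm w →
    (cWilfWords v w → cWilfPerms v w) × (strongCWilfWords v w → strongCWilfPerms v w)
-- The argument never uses that v and w are permutations.
corollary1 d v w _ _ =
  (λ same n n≥1 → perms-from-words v w 0 n n≥1 (λ k k≥1 → same k n k≥1 n≥1)) ,
  (λ same n r n≥1 → perms-from-words v w r n n≥1 (λ k k≥1 → same k n r k≥1 n≥1))
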